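{- Let $i\geq 1$ be an integer, $G$ a multigraph and $(L,\mathcal H)$ a cover of $G$ such that for every $u\in V(G)$, $d_G(u)+1\leq |L(u)|\,(i+1)$. Then there is an $\mathcal H$-map $\phi$ such that every vertex of $\mathcal H_\phi$ has degree at most $i$ in $\mathcal H_\phi$.
   Context: Multigraphs are finite without loops; $d_G(u)$ is the number of edges of $G$ incident with $u$. A cover of a multigraph $G$ is a pair $(L,\mathcal H)$ where $\mathcal H$ is a graph and $L:V(G)\to 2^{V(\mathcal H)}$ satisfies: the sets $L(u)$, $u\in V(G)$, partition $V(\mathcal H)$; each $\mathcal H[L(u)]$ is complete; if $\mathcal H$ has an edge between $L(u)$ and $L(v)$ then $u=v$ or $uv\in E(G)$; and if the edge $uv$ has multiplicity $k$ in $G$, then $\mathcal H[L(u),L(v)]$ is the union of at most $k$ matchings between $L(u)$ and $L(v)$. An $\mathcal H$-map is a function $\phi$ on $V(G)$ with $\phi(v)\in L(v)$ for every $v$; $\mathcal H_\phi$ is the subgraph of $\mathcal H$ induced by $\phi(V(G))$. -}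

module Defs where

open import Data.Nat using (ℕ; zero; suc; _+_)
open import Data.Fin using (Fin; zero; suc)
open import Data.Bool using (Bool; true; false; if_then_else_)
open import Data.Product using (Σ; _,_)
open import Relation.Binary.PropositionalEquality using (_≡_; _≢_)

sumFin : (n : ℕ) → (Fin n → ℕ) → ℕ
sumFin zero    f = 0
sumFin (suc n) f = f zero + sumFin n (λ v → f (suc v))

record Multigraph (n : ℕ) : Set where
  field
    mult     : Fin n → Fin n → ℕ
    mult-sym : ∀ u v → mult u v ≡ mult v u
    loopless : ∀ u → mult u u ≡ 0

open Multigraph public

deg : ∀ {n} → Multigraph n → Fin n → ℕ
deg {n} G u = sumFin n (λ v → mult G u v)

-- V(H) = Σ u, Fin (size u), and L(u) = {u} × Fin (size u),
-- so the sets L(u) partition V(H) and |L(u)| = size u.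
record Cover {n : ℕ} (G : Multigraph n) : Set where
  field
    size      : Fin n → ℕ
    adj       : Σ (Fin n) (λ u → Fin (size u)) → Σ (Fin n) (λ u → Fin (size u)) → Bool
    adj-sym   : ∀ x y → adj x y ≡ adj y x
    adj-irr   : ∀ x → adj x x ≡ false
    complete  : ∀ u (a b : Fin (size u)) → a ≢ b → adj (u , a) (u , b) ≡ true
    -- for u ≠ v, H[L(u),L(v)] is the union of at most mult u v matchings:
    -- its edges can be coloured with colours in Fin (mult u v) so that each
    -- colour class is a matching.  (If mult u v = 0 this forces no edges.)
    colour    : ∀ u v → u ≢ v → (a : Fin (size u)) (b : Fin (size v)) →
                adj (u , a) (v , b) ≡ true → Fin (mult G u v)
    matchingˡ : ∀ u v (uv : u ≢ v) (a : Fin (size u)) (b b' : Fin (size v)) →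
                b ≢ b' → (e : adj (u , a) (v , b) ≡ true) → (e' : adj (u , a) (v , b') ≡ true) →
                colour u v uv a b e ≢ colour u v uv a b' e'
    matchingʳ : ∀ u v (uv : u ≢ v) (a a' : Fin (size u)) (b : Fin (size v)) →
                a ≢ a' → (e : adj (u , a) (v , b) ≡ true) → (e' : adj (u , a') (v , b) ≡ true) →
                colour u v uv a b e ≢ colour u v uv a' b e'

open Cover public

HMap : ∀ {n} {G : Multigraph n} → Cover G → Set
HMap {n} C = (u : Fin n) → Fin (size C u)

degφ : ∀ {n} {G : Multigraph n} (C : Cover G) → HMap C → Fin n → ℕ
degφ {n} C φ u = sumFin n (λ w → if adj C (u , φ u) (w , φ w) then 1 else 0)

module Submission where

-- For an H-map φ let M(φ) = Σ_u deg_{H_φ}(φ u), twice the number of edges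
-- of H_φ.  Moving φ(u) to another c ∈ L(u) only changes edges at u, so by
-- the "handshake at u" decomposition M(φ) = 2·deg_{H_φ}(φ u) + R, where R
-- does not depend on φ(u); hence recolouring u to a colour of smaller degree
-- strictly decreases M.  Such a colour exists whenever deg(φ u) > i: for a
-- fixed neighbour w of u the edges between L(u) and φ(w) lie in at most
-- mult(u,w) matchings, so summed over all c ∈ L(u) the degrees of c are at
-- most d_G(u) < |L(u)|(i+1), and by pigeonhole some c has degree ≤ i.
-- Since M ∈ ℕ, iterating terminates in an H-map with all degrees ≤ i.

open import Defs
open import Data.Nat using (ℕ; _+_; _*_; _≤_; suc; zero; _<_; z≤n; s≤s; _≤?_)
open import Data.Nat.Properties
open import Algebra.Properties.CommutativeMonoid.Sum +-0-commutativeMonoid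
  using (sum; ∑-comm; ∑-distrib-+; sum-cong-≗)
open import Data.Fin using (Fin; zero; suc; punchOut)
open import Data.Fin.Properties using (punchOut-injective; all?; ¬∀⟶∃¬)
  renaming (_≟_ to _≟ᶠ_; suc-injective to fin-suc-injective)
open import Data.Bool using (Bool; true; false; if_then_else_)
open import Data.Product using (Σ; _,_)
open import Data.Sum using (_⊎_; inj₁; inj₂)
open import Relation.Nullary using (¬_; Dec; yes; no; does; contradiction)
open import Relation.Binary.PropositionalEquality
  using (_≡_; _≢_; ≢-sym; refl; sym; trans; cong; cong₂; subst; module ≡-Reasoning)
open import Function using (_∘_)

[_] : Bool → ℕ
[ b ] = if b then 1 else 0

sumFin≡sum : ∀ n (f : Fin n → ℕ) → sumFin n f ≡ sum f
sumFin≡sum zero    f = refl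
sumFin≡sum (suc n) f = cong (f zero +_) (sumFin≡sum n (λ v → f (suc v)))

sum-cong : ∀ n {f g : Fin n → ℕ} → (∀ v → f v ≡ g v) → sumFin n f ≡ sumFin n g
sum-cong zero    f≗g = refl
sum-cong (suc n) f≗g = cong₂ _+_ (f≗g zero) (sum-cong n (λ v → f≗g (suc v)))

sum-mono : ∀ n {f g : Fin n → ℕ} → (∀ v → f v ≤ g v) → sumFin n f ≤ sumFin n g
sum-mono zero    f≤g = z≤n
sum-mono (suc n) f≤g = +-mono-≤ (f≤g zero) (sum-mono n (λ v → f≤g (suc v)))

sum-const : ∀ n k → sumFin n (λ _ → k) ≡ n * k
sum-const zero    k = refl
sum-const (suc n) k = cong (k +_) (sum-const n k)

sum-+ : ∀ n (f g : Fin n → ℕ) → sumFin n (λ v → f v + g v) ≡ sumFin n f + sumFin n g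
sum-+ n f g = begin
  sumFin n (λ v → f v + g v)  ≡⟨ sumFin≡sum n _ ⟩
  sum (λ v → f v + g v)       ≡⟨ ∑-distrib-+ f g ⟩
  sum f + sum g               ≡⟨ sym (cong₂ _+_ (sumFin≡sum n f) (sumFin≡sum n g)) ⟩
  sumFin n f + sumFin n g     ∎
  where open ≡-Reasoning

sum-swap : ∀ n m (f : Fin n → Fin m → ℕ) →
  sumFin n (λ x → sumFin m (f x)) ≡ sumFin m (λ y → sumFin n (λ x → f x y))
sum-swap n m f = begin
  sumFin n (λ x → sumFin m (f x))        ≡⟨ asSum n m f ⟩
  sum (λ x → sum (f x))                  ≡⟨ ∑-comm f ⟩
  sum (λ y → sum (λ x → f x y))          ≡⟨ sym (asSum m n (λ y x → f x y)) ⟩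
  sumFin m (λ y → sumFin n (λ x → f x y)) ∎
  where
  open ≡-Reasoning
  asSum : ∀ n m (g : Fin n → Fin m → ℕ) → sumFin n (λ x → sumFin m (g x)) ≡ sum (λ x → sum (g x))
  asSum n m g = trans (sumFin≡sum n _) (sum-cong-≗ (λ x → sumFin≡sum m (g x)))

except : ∀ {n} → Fin n → (Fin n → ℕ) → Fin n → ℕ
except u f x = if does (x ≟ᶠ u) then 0 else f x

except-+ : ∀ {n} (u : Fin n) (f g : Fin n → ℕ) x →
  except u (λ v → f v + g v) x ≡ except u f x + except u g x
except-+ u f g x with x ≟ᶠ u
... | yes _ = refl
... | no  _ = refl

except-cong : ∀ {n} (u : Fin n) {f g : Fin n → ℕ} → (∀ x → x ≢ u → f x ≡ g x) →
  ∀ x → except u f x ≡ except u g x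
except-cong u f≗g x with x ≟ᶠ u
... | yes _   = refl
... | no  x≢u = f≗g x x≢u

sum-except : ∀ n (u : Fin n) (f : Fin n → ℕ) → sumFin n f ≡ f u + sumFin n (except u f)
sum-except (suc n) zero    f = refl
sum-except (suc n) (suc u) f = begin
  f zero + sumFin n (λ v → f (suc v))
    ≡⟨ cong (f zero +_) (sum-except n u (λ v → f (suc v))) ⟩
  f zero + (f (suc u) + rest)
    ≡⟨ +-comm (f zero) _ ⟩
  f (suc u) + rest + f zero
    ≡⟨ +-assoc (f (suc u)) rest (f zero) ⟩
  f (suc u) + (rest + f zero)
    ≡⟨ cong (f (suc u) +_) (+-comm rest (f zero)) ⟩
  f (suc u) + (f zero + rest) ∎
  where
  open ≡-Reasoning
  rest = sumFin n (except u (λ v → f (suc v)))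

rest : ∀ {n} → Fin n → (Fin n → Fin n → ℕ) → ℕ
rest {n} u A = sumFin n (except u (λ x → sumFin n (except u (A x))))

rest-cong : ∀ {n} (u : Fin n) {A A' : Fin n → Fin n → ℕ} →
  (∀ x w → x ≢ u → w ≢ u → A x w ≡ A' x w) → rest u A ≡ rest u A'
rest-cong {n} u A≗A' = sum-cong n (except-cong u λ x x≢u →
  sum-cong n (except-cong u λ w w≢u → A≗A' x w x≢u w≢u))

handshake-at : ∀ n (A : Fin n → Fin n → ℕ) → (∀ x w → A x w ≡ A w x) →
  (u : Fin n) → A u u ≡ 0 →
  sumFin n (λ x → sumFin n (A x)) ≡ sumFin n (A u) + (sumFin n (A u) + rest u A)
handshake-at n A sym-A u Auu≡0 = begin
  sumFin n (λ x → sumFin n (A x))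
    ≡⟨ sum-except n u _ ⟩
  d + sumFin n (except u (λ x → sumFin n (A x)))
    ≡⟨ cong (d +_) (sum-cong n (except-cong u λ x _ → sum-except n u (A x))) ⟩
  d + sumFin n (except u (λ x → A x u + sumFin n (except u (A x))))
    ≡⟨ cong (d +_) (sum-cong n (except-+ u _ _)) ⟩
  d + sumFin n (λ x → except u (λ y → A y u) x + except u (λ y → sumFin n (except u (A y))) x)
    ≡⟨ cong (d +_) (sum-+ n _ _) ⟩
  d + (sumFin n (except u (λ y → A y u)) + rest u A)
    ≡⟨ cong (λ e → d + (e + rest u A)) column≡row ⟩
  d + (d + rest u A) ∎
  where
  open ≡-Reasoning
  d = sumFin n (A u)
  column≡row : sumFin n (except u (λ y → A y u)) ≡ d
  column≡row = begin
    sumFin n (except u (λ y → A y u))          ≡⟨ cong (_+ sumFin n (except u (λ y → A y u))) (sym Auu≡0) ⟩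
    A u u + sumFin n (except u (λ y → A y u))  ≡⟨ sym (sum-except n u (λ y → A y u)) ⟩
    sumFin n (λ y → A y u)                     ≡⟨ sum-cong n (λ y → sym-A y u) ⟩
    d                                          ∎

count-injective : ∀ s m (P : Fin s → Bool) (col : ∀ c → P c ≡ true → Fin m) →
  (∀ a a' pa pa' → a ≢ a' → col a pa ≢ col a' pa') →
  sumFin s (λ c → [ P c ]) ≤ m
count-injective zero    m P col inj = z≤n
count-injective (suc s) m P col inj with P zero in P0
... | false = count-injective s m (λ c → P (suc c)) (λ c → col (suc c))
                (λ a a' pa pa' a≢a' → inj (suc a) (suc a') pa pa' (a≢a' ∘ fin-suc-injective))
... | true  = with-first m col inj
  where
  -- The colour of 0 is used, so the remaining elements use the other m - 1.
  with-first : ∀ m (col : ∀ c → P c ≡ true → Fin m) →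
    (∀ a a' pa pa' → a ≢ a' → col a pa ≢ col a' pa') →
    suc (sumFin s (λ c → [ P (suc c) ])) ≤ m
  with-first zero     col inj with col zero P0
  ... | ()
  with-first (suc m') col inj =
    s≤s (count-injective s m' (λ c → P (suc c)) col' inj')
    where
    apart : ∀ c pc → col zero P0 ≢ col (suc c) pc
    apart c pc = inj zero (suc c) P0 pc (λ ())
    col' : ∀ c → P (suc c) ≡ true → Fin m'
    col' c pc = punchOut (apart c pc)
    inj' : ∀ a a' pa pa' → a ≢ a' → col' a pa ≢ col' a' pa'
    inj' a a' pa pa' a≢a' same = inj (suc a) (suc a') pa pa' (λ e → a≢a' (fin-suc-injective e))
                                   (punchOut-injective (apart a pa) (apart a' pa') same)

pigeonhole : ∀ s k (g : Fin s → ℕ) → sumFin s g < s * k → Σ (Fin s) (λ c → g c < k)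
pigeonhole s k g sum<s*k with ¬∀⟶∃¬ s (λ c → k ≤ g c) (λ c → k ≤? g c) all-large
  where
  all-large : ¬ (∀ c → k ≤ g c)
  all-large k≤g = <⇒≱ sum<s*k (subst (_≤ sumFin s g) (sum-const s k) (sum-mono s k≤g))
... | c , k≰gc = c , ≰⇒> k≰gc

descent : ∀ {a p} {X : Set a} {P : X → Set p} (μ : X → ℕ) →
  (∀ x → P x ⊎ Σ X (λ y → μ y < μ x)) → X → Σ X P
descent {X = X} {P} μ step x₀ = go (suc (μ x₀)) x₀ ≤-refl
  where
  go : ∀ fuel x → μ x < fuel → Σ X P
  go (suc fuel) x μx<1+fuel with step x
  ... | inj₁ px       = x , px
  ... | inj₂ (y , lt) = go fuel y (<-≤-trans lt (≤-pred μx<1+fuel))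

module Recolouring {n : ℕ} (G : Multigraph n) (C : Cover G) where

  -- Adjacency matrix of H_φ, indexed by V(G); its row sums are the degrees.
  A : HMap C → Fin n → Fin n → ℕ
  A φ x w = [ adj C (x , φ x) (w , φ w) ]

  A-sym : ∀ φ x w → A φ x w ≡ A φ w x
  A-sym φ x w = cong [_] (adj-sym C (x , φ x) (w , φ w))

  A-irr : ∀ φ x → A φ x x ≡ 0
  A-irr φ x = cong [_] (adj-irr C (x , φ x))

  M : HMap C → ℕ
  M φ = sumFin n (degφ C φ)

  _[_≔_] : HMap C → (u : Fin n) → Fin (size C u) → HMap C
  (φ [ u ≔ c ]) w with w ≟ᶠ u
  ... | yes refl = c
  ... | no  _    = φ w

  update-at : ∀ φ u c → (φ [ u ≔ c ]) u ≡ c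
  update-at φ u c with u ≟ᶠ u
  ... | yes refl = refl
  ... | no  u≢u  = contradiction refl u≢u

  update-elsewhere : ∀ φ u c w → w ≢ u → (φ [ u ≔ c ]) w ≡ φ w
  update-elsewhere φ u c w w≢u with w ≟ᶠ u
  ... | yes w≡u = contradiction w≡u w≢u
  ... | no  _   = refl

  recolour-decreases : ∀ φ u c → degφ C (φ [ u ≔ c ]) u < degφ C φ u → M (φ [ u ≔ c ]) < M φ
  recolour-decreases φ u c d'<d = begin-strict
    M φ'                                 ≡⟨ handshake-at n (A φ') (A-sym φ') u (A-irr φ' u) ⟩
    degφ C φ' u + (degφ C φ' u + rest u (A φ'))
      <⟨ +-mono-< d'<d (+-monoˡ-< (rest u (A φ')) d'<d) ⟩
    degφ C φ u + (degφ C φ u + rest u (A φ'))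
      ≡⟨ cong (λ r → degφ C φ u + (degφ C φ u + r)) (rest-cong u unchanged) ⟩
    degφ C φ u + (degφ C φ u + rest u (A φ)) ≡⟨ sym (handshake-at n (A φ) (A-sym φ) u (A-irr φ u)) ⟩
    M φ                                  ∎
    where
    open ≤-Reasoning
    φ' = φ [ u ≔ c ]
    unchanged : ∀ x w → x ≢ u → w ≢ u → A φ' x w ≡ A φ x w
    unchanged x w x≢u w≢u = cong₂ (λ a b → [ adj C (x , a) (w , b) ])
      (update-elsewhere φ u c x x≢u) (update-elsewhere φ u c w w≢u)

  -- For fixed w, the number of c ∈ L(u) adjacent to φ(w) is at most mult(u,w):
  -- those edges lie in mult(u,w) matchings.
  choices-per-neighbour : ∀ φ u w → sumFin (size C u) (λ c → A (φ [ u ≔ c ]) u w) ≤ mult G u w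
  choices-per-neighbour φ u w = by-cases (w ≟ᶠ u)
    where
    -- A separate function, so that the test w ≟ u inside φ [ u ≔ c ] is not abstracted.
    by-cases : Dec (w ≡ u) → sumFin (size C u) (λ c → A (φ [ u ≔ c ]) u w) ≤ mult G u w
    by-cases (yes refl) = subst (_≤ mult G u u)
      (sym (trans (sum-cong (size C u) (λ c → A-irr (φ [ u ≔ c ]) u)) (trans (sum-const (size C u) 0) (*-zeroʳ (size C u)))))
      z≤n
    by-cases (no w≢u) = subst (_≤ mult G u w)
      (sum-cong (size C u) λ c → cong₂ (λ a b → [ adj C (u , a) (w , b) ])
         (sym (update-at φ u c)) (sym (update-elsewhere φ u c w w≢u)))
      (count-injective (size C u) (mult G u w) (λ c → adj C (u , c) (w , φ w))
         (λ c e → colour C u w (≢-sym w≢u) c (φ w) e)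
         (λ a a' e e' a≢a' → matchingʳ C u w (≢-sym w≢u) a a' (φ w) a≢a' e e'))

  choices-total : ∀ φ u → sumFin (size C u) (λ c → degφ C (φ [ u ≔ c ]) u) ≤ deg G u
  choices-total φ u = subst (_≤ deg G u) (sym (sum-swap (size C u) n (λ c → A (φ [ u ≔ c ]) u)))
                        (sum-mono n (choices-per-neighbour φ u))

  good-choice : ∀ i → (∀ u → deg G u + 1 ≤ size C u * (i + 1)) →
    ∀ φ u → Σ (Fin (size C u)) (λ c → degφ C (φ [ u ≔ c ]) u ≤ i)
  good-choice i hyp φ u with pigeonhole (size C u) (i + 1) (λ c → degφ C (φ [ u ≔ c ]) u) total<
    where
    total< : sumFin (size C u) (λ c → degφ C (φ [ u ≔ c ]) u) < size C u * (i + 1)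
    total< = <-≤-trans (s≤s (choices-total φ u))
               (subst (_≤ size C u * (i + 1)) (+-comm (deg G u) 1) (hyp u))
  ... | c , lt = c , ≤-pred (subst (degφ C (φ [ u ≔ c ]) u <_) (+-comm i 1) lt)

initial-map : ∀ {n} {G : Multigraph n} (C : Cover G) (k : ℕ) →
  (∀ u → 1 ≤ size C u * k) → HMap C
initial-map C k nonempty u with size C u | nonempty u
... | suc _ | _ = zero

lemma3p2 : (i : ℕ) → 1 ≤ i → (n : ℕ) (G : Multigraph n) (C : Cover G) →
    (∀ u → deg G u + 1 ≤ size C u * (i + 1)) →
    Σ (HMap C) (λ φ → ∀ u → degφ C φ u ≤ i)
lemma3p2 i _ n G C hyp = descent M step φ₀
  where
  open Recolouring G C
  φ₀ : HMap C
  φ₀ = initial-map C (i + 1) (λ u → ≤-trans (m≤n+m 1 (deg G u)) (hyp u))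
  step : ∀ φ → (∀ u → degφ C φ u ≤ i) ⊎ Σ (HMap C) (λ φ' → M φ' < M φ)
  step φ with all? (λ u → degφ C φ u ≤? i)
  ... | yes all-good = inj₁ all-good
  ... | no not-all with ¬∀⟶∃¬ n _ (λ u → degφ C φ u ≤? i) not-all
  ...   | u , bad with good-choice i hyp φ u
  ...     | c , good = inj₂ (φ [ u ≔ c ] , recolour-decreases φ u c (≤-<-trans good (≰⇒> bad)))
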